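{- Let $A$ be a commutative unital ring of characteristic $0$, let $n\ge4$, let $k\in\{3,\ldots,n-1\}$ and let $(b_1,\ldots,b_k)\in A^k$. Let $(a_1,\ldots,a_n)=(1_A,n_A-2_A,1_A,2_A,\ldots,2_A)$ (the last $n-3$ entries equal to $2_A$). Suppose $(b_1,\ldots,b_k)$ can be used to reduce $(a_1,\ldots,a_n)$, i.e. $(b_1,\ldots,b_k)$ is a $\lambda$-quiddity over $A$ and there exists $(c_1,\ldots,c_{n+2-k})\in A^{n+2-k}$ with $(a_1,\ldots,a_n)\sim(c_1,\ldots,c_{n+2-k})\oplus(b_1,\ldots,b_k)$. Then $(b_1,\ldots,b_k)$ is of the form $(x,1_A,2_A,\ldots,2_A,y)$ or $(x,2_A,\ldots,2_A,1_A,y)$ for some $x,y\in A$ (the number of entries $2_A$ possibly being zero).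
   Context: For $a_1,\ldots,a_n\in A$, $M_n(a_1,\ldots,a_n)=\begin{pmatrix}a_n&-1\\1&0\end{pmatrix}\cdots\begin{pmatrix}a_1&-1\\1&0\end{pmatrix}$; an $n$-tuple is a $\lambda$-quiddity over $A$ if $M_n(a_1,\ldots,a_n)=\pm Id$. For $k\in\mathbb{N}^*$, $k_A=\sum_{i=1}^k1_A$. For $(a_1,\ldots,a_n)\in A^n$, $(b_1,\ldots,b_m)\in A^m$, $(a_1,\ldots,a_n)\oplus(b_1,\ldots,b_m)=(a_1+b_m,a_2,\ldots,a_{n-1},a_n+b_1,b_2,\ldots,b_{m-1})$. $(a_1,\ldots,a_n)\sim(b_1,\ldots,b_n)$ means $(b_1,\ldots,b_n)$ is obtained by a cyclic permutation of $(a_1,\ldots,a_n)$ or of $(a_n,\ldots,a_1)$. -}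

module Defs where

open import Level using (Level; _⊔_)
open import Data.Nat using (ℕ; zero; suc)
open import Data.Product using (_×_; _,_; ∃)
open import Data.Sum using (_⊎_)
open import Data.Empty using (⊥)
open import Data.List using (List; []; _∷_; _++_; drop; take; reverse)
open import Data.List.Relation.Binary.Pointwise using (Pointwise)
open import Algebra.Bundles using (CommutativeRing)

module _ {c ℓ : Level} (R : CommutativeRing c ℓ) where
  open CommutativeRing R renaming (Carrier to A)

  natA : ℕ → A
  natA zero    = 0#
  natA (suc k) = 1# + natA k

  CharZero : Set ℓ
  CharZero = ∀ k → natA (suc k) ≈ 0# → ⊥

  record M2 : Set c where
    constructor mat
    field m11 m12 m21 m22 : A

  _⊗_ : M2 → M2 → M2
  mat a b c' d ⊗ mat e f g h =
    mat (a * e + b * g) (a * f + b * h) (c' * e + d * g) (c' * f + d * h)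

  _≈M_ : M2 → M2 → Set ℓ
  mat a b c' d ≈M mat e f g h = (a ≈ e) × (b ≈ f) × (c' ≈ g) × (d ≈ h)

  IdM : M2
  IdM = mat 1# 0# 0# 1#

  negIdM : M2
  negIdM = mat (- 1#) 0# 0# (- 1#)

  E : A → M2
  E a = mat a (- 1#) 1# 0#

  Mn : List A → M2
  Mn []       = IdM
  Mn (a ∷ as) = Mn as ⊗ E a

  IsLambdaQuiddity : List A → Set ℓ
  IsLambdaQuiddity as = (Mn as ≈M IdM) ⊎ (Mn as ≈M negIdM)

  initLast′ : A → List A → List A × A
  initLast′ x []       = [] , x
  initLast′ x (y ∷ ys) with initLast′ y ys
  ... | i , l = x ∷ i , l

  -- (a_1,...,a_n) ⊕ (b_1,...,b_m)
  --   = (a_1 + b_m, a_2, ..., a_{n-1}, a_n + b_1, b_2, ..., b_{m-1})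
  -- meaningful for n, m ≥ 2 (only used in that case); junk [] otherwise
  _⊕_ : List A → List A → List A
  (a₁ ∷ a₂ ∷ as) ⊕ (b₁ ∷ b₂ ∷ bs) with initLast′ a₂ as | initLast′ b₂ bs
  ... | amid , aₙ | bmid , bₘ = (a₁ + bₘ) ∷ (amid ++ ((aₙ + b₁) ∷ bmid))
  _ ⊕ _ = []

  _≈L_ : List A → List A → Set (c ⊔ ℓ)
  _≈L_ = Pointwise _≈_

  rotate : ℕ → List A → List A
  rotate i xs = drop i xs ++ take i xs

  _∼_ : List A → List A → Set (c ⊔ ℓ)
  as ∼ bs = ∃ λ i → (bs ≈L rotate i as) ⊎ (bs ≈L rotate i (reverse as))

-- The inner block (b₂, …, b_{k-1}) of a λ-quiddity has continuant ±1: it is read off the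
-- bottom-right entry of M_k(b₁, …, b_k). If (b₁, …, b_k) reduces (a₁, …, a_n), this block is
-- a cyclic window of (1, n-2, 1, 2, …, 2), possibly reversed, of length between 1 and n-3.
-- The continuant of a window of 2's is its length plus one, and that of a window through
-- the entry n-2 is n-1 minus its length; in characteristic 0 both are ≠ ±1 for the lengths
-- at hand. The windows left over are (1, 2, …, 2) and (2, …, 2, 1).
module Submission where

open import Level using (Level; _⊔_)
open import Data.Nat as ℕ using (ℕ; zero; suc; _≤_; _<_; _∸_; _⊓_; s≤s; z≤n) renaming (_+_ to _+ℕ_)
import Data.Nat.Properties as ℕ
open import Data.Integer as ℤ using (ℤ; +_; -[1+_]; _⊖_; _◃_)
import Data.Integer.Properties as ℤ
open import Data.Sign as Sign using (Sign)
import Data.Maybe as Maybe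
open import Data.Product using (_×_; _,_; proj₁; proj₂; ∃; ∃₂)
open import Data.Sum using (_⊎_; inj₁; inj₂)
open import Data.Empty using (⊥; ⊥-elim)
open import Data.List using (List; []; _∷_; _++_; drop; take; reverse; replicate; length)
import Data.List.Properties as List
open import Data.List.Relation.Binary.Pointwise using (Pointwise; []; _∷_)
open import Relation.Nullary using (yes; no)
open import Relation.Nullary.Decidable using (dec⇒maybe)
open import Relation.Binary.PropositionalEquality as ≡ using (_≡_)
open import Algebra.Bundles using (CommutativeRing)
open import Algebra.Solver.Ring.AlmostCommutativeRing
  using (fromCommutativeRing; _-Raw-AlmostCommutative⟶_)
import Algebra.Solver.Ring as RingSolver
import Algebra.Properties.Ring as RingProperties
import Algebra.Properties.CommutativeSemigroup as CommutativeSemigroupProperties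
import Algebra.Properties.Semiring.Mult.TCOptimised as OptimisedMult
import Data.List.Relation.Binary.Equality.Setoid as SetoidEquality
open import Defs

2≤[3+r]∸k : ∀ {k r} → k ≤ r → 2 ≤ suc (r +ℕ 2) ∸ k
2≤[3+r]∸k {zero}  {r} _  = ℕ.m≤n⇒m≤1+n (ℕ.m≤n+m 2 r)
2≤[3+r]∸k {suc k} (s≤s k≤r) = 2≤[3+r]∸k k≤r

module _ {a} {X : Set a} where

  drop-replicate : ∀ i n (x : X) → drop i (replicate n x) ≡ replicate (n ∸ i) x
  drop-replicate zero    n       x = ≡.refl
  drop-replicate (suc i) zero    x = ≡.refl
  drop-replicate (suc i) (suc n) x = drop-replicate i n x

  take-replicate : ∀ i n (x : X) → take i (replicate n x) ≡ replicate (i ⊓ n) x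
  take-replicate zero    n       x = ≡.refl
  take-replicate (suc i) zero    x = ≡.refl
  take-replicate (suc i) (suc n) x = ≡.cong (x ∷_) (take-replicate i n x)

  drop-replicate-++ : ∀ {i n} (x : X) ys → i ≤ n → drop i (replicate n x ++ ys) ≡ replicate (n ∸ i) x ++ ys
  drop-replicate-++ x ys z≤n       = ≡.refl
  drop-replicate-++ x ys (s≤s i≤n) = drop-replicate-++ x ys i≤n

  take-replicate-++ : ∀ {i n} (x : X) ys → i ≤ n → take i (replicate n x ++ ys) ≡ replicate i x
  take-replicate-++ x ys z≤n       = ≡.refl
  take-replicate-++ x ys (s≤s i≤n) = ≡.cong (x ∷_) (take-replicate-++ x ys i≤n)

  drop-+-replicate-++ : ∀ n k (x : X) ys → drop (n +ℕ k) (replicate n x ++ ys) ≡ drop k ys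
  drop-+-replicate-++ zero    k x ys = ≡.refl
  drop-+-replicate-++ (suc n) k x ys = drop-+-replicate-++ n k x ys

  take-+-replicate-++ : ∀ n k (x : X) ys → take (n +ℕ k) (replicate n x ++ ys) ≡ replicate n x ++ take k ys
  take-+-replicate-++ zero    k x ys = ≡.refl
  take-+-replicate-++ (suc n) k x ys = ≡.cong (x ∷_) (take-+-replicate-++ n k x ys)

  length-replicate-++ : ∀ n (x : X) ys → length (replicate n x ++ ys) ≡ n +ℕ length ys
  length-replicate-++ zero    x ys = ≡.refl
  length-replicate-++ (suc n) x ys = ≡.cong suc (length-replicate-++ n x ys)

  drop-suc-length-++ : ∀ (xs : List X) y ys → drop (suc (length xs)) (xs ++ y ∷ ys) ≡ ys
  drop-suc-length-++ []       y ys = ≡.refl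
  drop-suc-length-++ (x ∷ xs) y ys = drop-suc-length-++ xs y ys

  replicate-∷ʳ : ∀ n (x : X) → replicate n x ++ x ∷ [] ≡ x ∷ replicate n x
  replicate-∷ʳ zero    x = ≡.refl
  replicate-∷ʳ (suc n) x = ≡.cong (x ∷_) (replicate-∷ʳ n x)

  reverse-replicate : ∀ n (x : X) → reverse (replicate n x) ≡ replicate n x
  reverse-replicate zero    x = ≡.refl
  reverse-replicate (suc n) x = ≡.trans (List.unfold-reverse x (replicate n x))
    (≡.trans (≡.cong (_++ x ∷ []) (reverse-replicate n x)) (replicate-∷ʳ n x))

  module Suffixes {p} (P : List X → Set p) where

    AllSuffixes : List X → Set p
    AllSuffixes xs = ∀ m → P (drop m xs)

    allSuffixes-[] : P [] → AllSuffixes []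
    allSuffixes-[] P[] m = ≡.subst P (≡.sym (List.drop-[] m)) P[]

    allSuffixes-∷ : ∀ {x xs} → P (x ∷ xs) → AllSuffixes xs → AllSuffixes (x ∷ xs)
    allSuffixes-∷ P[x∷xs] all-xs zero    = P[x∷xs]
    allSuffixes-∷ P[x∷xs] all-xs (suc m) = all-xs m

  Pointwise-drop : ∀ {ℓ} {_∼_ : X → X → Set ℓ} m {xs ys} → Pointwise _∼_ xs ys → Pointwise _∼_ (drop m xs) (drop m ys)
  Pointwise-drop zero    xs∼ys        = xs∼ys
  Pointwise-drop (suc m) []           = []
  Pointwise-drop (suc m) (_ ∷ xs∼ys) = Pointwise-drop m xs∼ys

module IntegerCoefficients {c ℓ : Level} (R : CommutativeRing c ℓ) where
  open CommutativeRing R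
  open RingProperties ring using (-‿involutive; -0#≈0#; -‿distribˡ-*; -‿distribʳ-*; -‿+-comm)
  open CommutativeSemigroupProperties +-commutativeSemigroup using (interchange)
  open OptimisedMult semiring using (×-homo-+; ×1-homo-*; 1+×) renaming (_×_ to _·_)
  open import Relation.Binary.Reasoning.Setoid setoid

  -- The optimised multiplication gives ⟦ + 1 ⟧ℤ = 1#, so the solver's constants unfold to
  -- the ring's own 0#, 1#, - 1#.
  ⟦_⟧ℤ : ℤ → Carrier
  ⟦ + n ⟧ℤ      = n · 1#
  ⟦ -[1+ n ] ⟧ℤ = - (suc n · 1#)

  ⟦⊖⟧ : ∀ m n → ⟦ m ⊖ n ⟧ℤ ≈ m · 1# - n · 1#
  ⟦⊖⟧ m zero = begin
    ⟦ m ⊖ 0 ⟧ℤ      ≡⟨ ≡.cong ⟦_⟧ℤ (ℤ.⊖-≥ {m} z≤n) ⟩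
    m · 1#          ≈⟨ +-identityʳ _ ⟨
    m · 1# + 0#     ≈⟨ +-congˡ -0#≈0# ⟨
    m · 1# - 0#     ∎
  ⟦⊖⟧ zero (suc n) = begin
    ⟦ 0 ⊖ suc n ⟧ℤ  ≡⟨ ≡.cong ⟦_⟧ℤ (ℤ.⊖-< {0} {suc n} (s≤s z≤n)) ⟩
    - (suc n · 1#)  ≈⟨ +-identityˡ _ ⟨
    0# - suc n · 1# ∎
  ⟦⊖⟧ (suc m) (suc n) = begin
    ⟦ suc m ⊖ suc n ⟧ℤ               ≡⟨ ≡.cong ⟦_⟧ℤ (ℤ.[1+m]⊖[1+n]≡m⊖n m n) ⟩
    ⟦ m ⊖ n ⟧ℤ                       ≈⟨ ⟦⊖⟧ m n ⟩
    m · 1# - n · 1#                  ≈⟨ +-identityˡ _ ⟨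
    0# + (m · 1# - n · 1#)           ≈⟨ +-congʳ (-‿inverseʳ 1#) ⟨
    (1# - 1#) + (m · 1# - n · 1#)    ≈⟨ interchange 1# (- 1#) (m · 1#) (- (n · 1#)) ⟩
    (1# + m · 1#) + (- 1# - n · 1#)  ≈⟨ +-congˡ (-‿+-comm 1# (n · 1#)) ⟩
    (1# + m · 1#) - (1# + n · 1#)    ≈⟨ +-cong (1+× m 1#) (-‿cong (1+× n 1#)) ⟨
    suc m · 1# - suc n · 1#          ∎

  +-homo : ∀ i j → ⟦ i ℤ.+ j ⟧ℤ ≈ ⟦ i ⟧ℤ + ⟦ j ⟧ℤ
  +-homo (+ m)    (+ n)    = ×-homo-+ 1# m n
  +-homo (+ m)    -[1+ n ] = ⟦⊖⟧ m (suc n)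
  +-homo -[1+ m ] (+ n)    = trans (⟦⊖⟧ n (suc m)) (+-comm _ _)
  +-homo -[1+ m ] -[1+ n ] = begin
    - (suc (suc (m +ℕ n)) · 1#)   ≡⟨ ≡.cong (λ k → - (k · 1#)) (ℕ.+-suc (suc m) n) ⟨
    - ((suc m +ℕ suc n) · 1#)     ≈⟨ -‿cong (×-homo-+ 1# (suc m) (suc n)) ⟩
    - (suc m · 1# + suc n · 1#)   ≈⟨ -‿+-comm _ _ ⟨
    - (suc m · 1#) - suc n · 1#   ∎

  -‿homo : ∀ i → ⟦ ℤ.- i ⟧ℤ ≈ - ⟦ i ⟧ℤ
  -‿homo (+ zero)  = sym -0#≈0#
  -‿homo (+ suc n) = refl
  -‿homo -[1+ n ]  = sym (-‿involutive _)

  signed : Sign → Carrier → Carrier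
  signed Sign.+ x = x
  signed Sign.- x = - x

  signed-cong : ∀ s {x y} → x ≈ y → signed s x ≈ signed s y
  signed-cong Sign.+ x≈y = x≈y
  signed-cong Sign.- x≈y = -‿cong x≈y

  signed-* : ∀ s t x y → signed (s Sign.* t) (x * y) ≈ signed s x * signed t y
  signed-* Sign.+ Sign.+ x y = refl
  signed-* Sign.+ Sign.- x y = -‿distribʳ-* x y
  signed-* Sign.- Sign.+ x y = -‿distribˡ-* x y
  signed-* Sign.- Sign.- x y = begin
    x * y        ≈⟨ -‿involutive _ ⟨
    - - (x * y)  ≈⟨ -‿cong (-‿distribˡ-* x y) ⟩
    - (- x * y)  ≈⟨ -‿distribʳ-* (- x) y ⟩
    - x * - y    ∎

  ⟦◃⟧ : ∀ s n → ⟦ s ◃ n ⟧ℤ ≈ signed s (n · 1#)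
  ⟦◃⟧ Sign.+ zero    = refl
  ⟦◃⟧ Sign.- zero    = sym -0#≈0#
  ⟦◃⟧ Sign.+ (suc n) = refl
  ⟦◃⟧ Sign.- (suc n) = refl

  ⟦⟧ℤ-signed : ∀ i → ⟦ i ⟧ℤ ≈ signed (ℤ.sign i) (ℤ.∣ i ∣ · 1#)
  ⟦⟧ℤ-signed (+ n)    = refl
  ⟦⟧ℤ-signed -[1+ n ] = refl

  *-homo : ∀ i j → ⟦ i ℤ.* j ⟧ℤ ≈ ⟦ i ⟧ℤ * ⟦ j ⟧ℤ
  *-homo i j = begin
    ⟦ s ◃ ℤ.∣ i ∣ ℕ.* ℤ.∣ j ∣ ⟧ℤ                                   ≈⟨ ⟦◃⟧ s (ℤ.∣ i ∣ ℕ.* ℤ.∣ j ∣) ⟩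
    signed s ((ℤ.∣ i ∣ ℕ.* ℤ.∣ j ∣) · 1#)                           ≈⟨ signed-cong s (×1-homo-* ℤ.∣ i ∣ ℤ.∣ j ∣) ⟩
    signed s (ℤ.∣ i ∣ · 1# * ℤ.∣ j ∣ · 1#)                          ≈⟨ signed-* (ℤ.sign i) (ℤ.sign j) _ _ ⟩
    signed (ℤ.sign i) (ℤ.∣ i ∣ · 1#) * signed (ℤ.sign j) (ℤ.∣ j ∣ · 1#) ≈⟨ *-cong (⟦⟧ℤ-signed i) (⟦⟧ℤ-signed j) ⟨
    ⟦ i ⟧ℤ * ⟦ j ⟧ℤ                                                 ∎
    where
    s : Sign
    s = ℤ.sign i Sign.* ℤ.sign j

  ℤ⟶R : ℤ.+-*-rawRing -Raw-AlmostCommutative⟶ fromCommutativeRing R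
  ℤ⟶R = record
    { ⟦_⟧ = ⟦_⟧ℤ ; +-homo = +-homo ; *-homo = *-homo ; -‿homo = -‿homo ; 0-homo = refl ; 1-homo = refl }

  open RingSolver ℤ.+-*-rawRing (fromCommutativeRing R) ℤ⟶R
    (λ i j → Maybe.map (λ i≡j → reflexive (≡.cong ⟦_⟧ℤ i≡j)) (dec⇒maybe (i ℤ.≟ j))) public

  -- A polynomial constant whose meaning is natA R k on the nose.
  :natA : ∀ {v} → ℕ → Polynomial v
  :natA zero    = con (+ 0)
  :natA (suc k) = con (+ 1) :+ :natA k

module _ {c ℓ : Level} (R : CommutativeRing c ℓ) where
  open CommutativeRing R renaming (Carrier to A)
  open RingProperties ring using (-‿involutive; -0#≈0#)
  open IntegerCoefficients R using (solve; _:=_; _:+_; _:-_; _:*_; :-_; con; :natA)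
  open SetoidEquality setoid using (_≋_; ≋-refl; ≋-trans; ≋-reflexive; ≋-length; ++⁺ʳ)
  open import Relation.Binary.Reasoning.Setoid setoid

  private
    ι : ℕ → A
    ι = natA R

  ι-+ : ∀ m n → ι (m +ℕ n) ≈ ι m + ι n
  ι-+ zero    n = sym (+-identityˡ (ι n))
  ι-+ (suc m) n = trans (+-congˡ (ι-+ m n)) (sym (+-assoc 1# (ι m) (ι n)))

  twos : ℕ → List A
  twos p = replicate p (ι 2)

  Is±1 : A → Set ℓ
  Is±1 x = x ≈ 1# ⊎ x ≈ - 1#

  Is±1-resp : ∀ {x y} → x ≈ y → Is±1 x → Is±1 y
  Is±1-resp x≈y (inj₁ x≈1)  = inj₁ (trans (sym x≈y) x≈1)
  Is±1-resp x≈y (inj₂ x≈-1) = inj₂ (trans (sym x≈y) x≈-1)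

  Is±1-neg : ∀ {x} → Is±1 (- x) → Is±1 x
  Is±1-neg {x} (inj₁ -x≈1)  = inj₂ (trans (sym (-‿involutive x)) (-‿cong -x≈1))
  Is±1-neg {x} (inj₂ -x≈-1) = inj₁ (trans (sym (-‿involutive x)) (trans (-‿cong -x≈-1) (-‿involutive 1#)))

  ι[2+m]-not-±1 : CharZero R → ∀ m {x} → x ≈ ι (2 +ℕ m) → Is±1 x → ⊥
  ι[2+m]-not-±1 charZero m {x} x≈ (inj₁ x≈1) = charZero m (begin
    ι (suc m)          ≈⟨ solve 1 (λ y → con (+ 1) :+ y := (con (+ 1) :+ (con (+ 1) :+ y)) :- con (+ 1)) refl (ι m) ⟩
    ι (2 +ℕ m) - 1#    ≈⟨ +-congʳ (trans (sym x≈) x≈1) ⟩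
    1# - 1#            ≈⟨ -‿inverseʳ 1# ⟩
    0#                 ∎)
  ι[2+m]-not-±1 charZero m {x} x≈ (inj₂ x≈-1) = charZero (2 +ℕ m) (begin
    1# + ι (2 +ℕ m)    ≈⟨ +-congˡ (trans (sym x≈) x≈-1) ⟩
    1# - 1#            ≈⟨ -‿inverseʳ 1# ⟩
    0#                 ∎)

  -- The top row of M_n(w); K w is the continuant of w.
  K K′ : List A → A
  K  w = M2.m11 (Mn R w)
  K′ w = M2.m12 (Mn R w)

  K-∷ : ∀ a w → K (a ∷ w) ≈ a * K w + K′ w
  K-∷ a w = solve 3 (λ k k′ a → k :* a :+ k′ :* con (+ 1) := a :* k :+ k′) refl (K w) (K′ w) a

  K′-∷ : ∀ a w → K′ (a ∷ w) ≈ - K w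
  K′-∷ a w = solve 2 (λ k k′ → k :* (:- con (+ 1)) :+ k′ :* con (+ 0) := :- k) refl (K w) (K′ w)

  K-cong : ∀ {w w′} → w ≋ w′ → K w ≈ K w′ × K′ w ≈ K′ w′
  K-cong []                      = refl , refl
  K-cong {a ∷ w} {a′ ∷ w′} (a≈a′ ∷ w≋w′) =
    trans (K-∷ a w) (trans (+-cong (*-cong a≈a′ K≈) K′≈) (sym (K-∷ a′ w′))) ,
    trans (K′-∷ a w) (trans (-‿cong K≈) (sym (K′-∷ a′ w′)))
    where
    K≈ : K w ≈ K w′
    K≈ = proj₁ (K-cong w≋w′)
    K′≈ : K′ w ≈ K′ w′
    K′≈ = proj₂ (K-cong w≋w′)

  bottom-row-∷ʳ : ∀ w y → M2.m21 (Mn R (w ++ y ∷ [])) ≈ K w × M2.m22 (Mn R (w ++ y ∷ [])) ≈ K′ w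
  bottom-row-∷ʳ [] y =
    solve 1 (λ y → con (+ 0) :* y :+ con (+ 1) :* con (+ 1) := con (+ 1)) refl y ,
    solve 0 (con (+ 0) :* (:- con (+ 1)) :+ con (+ 1) :* con (+ 0) := con (+ 0)) refl
  bottom-row-∷ʳ (a ∷ w) y = +-cong (*-congʳ m21≈) (*-congʳ m22≈) , +-cong (*-congʳ m21≈) (*-congʳ m22≈)
    where
    m21≈ : M2.m21 (Mn R (w ++ y ∷ [])) ≈ K w
    m21≈ = proj₁ (bottom-row-∷ʳ w y)
    m22≈ : M2.m22 (Mn R (w ++ y ∷ [])) ≈ K′ w
    m22≈ = proj₂ (bottom-row-∷ʳ w y)

  quiddity⇒inner-±1 : ∀ b w y → IsLambdaQuiddity R (b ∷ w ++ y ∷ []) → Is±1 (K w)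
  quiddity⇒inner-±1 b w y quiddity = Is±1-neg (Is±1-resp m22≈-Kw (corner quiddity))
    where
    v : List A
    v = w ++ y ∷ []
    m22≈-Kw : M2.m22 (Mn R (b ∷ v)) ≈ - K w
    m22≈-Kw = trans (solve 2 (λ x z → x :* (:- con (+ 1)) :+ z :* con (+ 0) := :- x) refl (M2.m21 (Mn R v)) (M2.m22 (Mn R v)))
                    (-‿cong (proj₁ (bottom-row-∷ʳ w y)))
    corner : IsLambdaQuiddity R (b ∷ v) → Is±1 (M2.m22 (Mn R (b ∷ v)))
    corner (inj₁ (_ , _ , _ , m22≈1))  = inj₁ m22≈1
    corner (inj₂ (_ , _ , _ , m22≈-1)) = inj₂ m22≈-1

  initLast′-length : ∀ x xs → length (proj₁ (initLast′ R x xs)) ≡ length xs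
  initLast′-length x []       = ≡.refl
  initLast′-length x (y ∷ ys) with initLast′ R y ys | initLast′-length y ys
  ... | _ , _ | |init|≡|ys| = ≡.cong suc |init|≡|ys|

  initLast′-++ : ∀ x xs → x ∷ xs ≡ proj₁ (initLast′ R x xs) ++ proj₂ (initLast′ R x xs) ∷ []
  initLast′-++ x []       = ≡.refl
  initLast′-++ x (y ∷ ys) with initLast′ R y ys | initLast′-++ y ys
  ... | _ , _ | y∷ys≡ = ≡.cong (x ∷_) y∷ys≡

  drop-⊕ : ∀ {cs} b₁ b₂ bs → 2 ≤ length cs → drop (length cs) (_⊕_ R cs (b₁ ∷ b₂ ∷ bs)) ≡ proj₁ (initLast′ R b₂ bs)
  drop-⊕ {_ ∷ []}       b₁ b₂ bs (s≤s ())
  drop-⊕ {c₁ ∷ c₂ ∷ cs} b₁ b₂ bs _ with initLast′ R c₂ cs | initLast′-length c₂ cs | initLast′ R b₂ bs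
  ... | init , last | |init|≡|cs| | inner , _ =
    ≡.subst (λ l → drop (suc l) (init ++ (last + b₁) ∷ inner) ≡ inner) |init|≡|cs| (drop-suc-length-++ init _ inner)

  K-twos : ∀ p → K (twos p) ≈ ι (suc p) × K′ (twos p) ≈ - ι p
  K-twos zero    = sym (+-identityʳ 1#) , sym -0#≈0#
  K-twos (suc p) = K≈ , trans (K′-∷ (ι 2) (twos p)) (-‿cong (proj₁ (K-twos p)))
    where
    K≈ : K (twos (suc p)) ≈ ι (2 +ℕ p)
    K≈ = begin
      K (ι 2 ∷ twos p)                ≈⟨ K-∷ (ι 2) (twos p) ⟩
      ι 2 * K (twos p) + K′ (twos p)  ≈⟨ +-cong (*-congˡ (proj₁ (K-twos p))) (proj₂ (K-twos p)) ⟩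
      ι 2 * ι (suc p) + - ι p         ≈⟨ solve 1 (λ x → :natA 2 :* (con (+ 1) :+ x) :+ :- x
                                                    := con (+ 1) :+ (con (+ 1) :+ x)) refl (ι p) ⟩
      ι (2 +ℕ p)                      ∎

  -- Prefixing 2 preserves K + K′, and adds K + K′ to K.
  K-twos-1∷ : ∀ p Y → K (twos p ++ 1# ∷ Y) ≈ K Y + ι (suc p) * K′ Y
                    × K (twos p ++ 1# ∷ Y) + K′ (twos p ++ 1# ∷ Y) ≈ K′ Y
  K-twos-1∷ zero Y =
    trans (K-∷ 1# Y) (solve 2 (λ k k′ → con (+ 1) :* k :+ k′ := k :+ (con (+ 1) :+ con (+ 0)) :* k′) refl (K Y) (K′ Y)) ,
    trans (+-cong (K-∷ 1# Y) (K′-∷ 1# Y)) (solve 2 (λ k k′ → (con (+ 1) :* k :+ k′) :+ :- k := k′) refl (K Y) (K′ Y))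
  K-twos-1∷ (suc p) Y = K≈ , trans (+-cong (K-∷ (ι 2) W) (K′-∷ (ι 2) W)) (trans (2∷-sum (K W) (K′ W)) (proj₂ (K-twos-1∷ p Y)))
    where
    W : List A
    W = twos p ++ 1# ∷ Y
    2∷-sum : ∀ u v → (ι 2 * u + v) + - u ≈ u + v
    2∷-sum = solve 2 (λ u v → (:natA 2 :* u :+ v) :+ :- u := u :+ v) refl
    K≈ : K (ι 2 ∷ W) ≈ K Y + ι (2 +ℕ p) * K′ Y
    K≈ = begin
      K (ι 2 ∷ W)                             ≈⟨ K-∷ (ι 2) W ⟩
      ι 2 * K W + K′ W                        ≈⟨ solve 2 (λ u v → :natA 2 :* u :+ v := u :+ (u :+ v)) refl (K W) (K′ W) ⟩
      K W + (K W + K′ W)                      ≈⟨ +-cong (proj₁ (K-twos-1∷ p Y)) (proj₂ (K-twos-1∷ p Y)) ⟩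
      (K Y + ι (suc p) * K′ Y) + K′ Y         ≈⟨ solve 3 (λ k k′ s → (k :+ s :* k′) :+ k′ := k :+ (con (+ 1) :+ s) :* k′)
                                                    refl (K Y) (K′ Y) (ι (suc p)) ⟩
      K Y + ι (2 +ℕ p) * K′ Y                 ∎

  TwosWithOneAtEnd : List A → Set (c ⊔ ℓ)
  TwosWithOneAtEnd w = ∃ λ j → w ≋ 1# ∷ twos j ⊎ w ≋ twos j ++ 1# ∷ []

  reduced-shape : ∀ {b} b₁ w y → b ≡ b₁ ∷ w ++ y ∷ [] → TwosWithOneAtEnd w →
    ∃₂ λ (x y′ : A) → ∃ λ j → b ≋ x ∷ 1# ∷ (twos j ++ y′ ∷ []) ⊎ b ≋ x ∷ (twos j ++ 1# ∷ y′ ∷ [])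
  reduced-shape b₁ w y ≡.refl (j , inj₁ w≋) = b₁ , y , j , inj₁ (refl ∷ ++⁺ʳ (y ∷ []) w≋)
  reduced-shape b₁ w y ≡.refl (j , inj₂ w≋) = b₁ , y , j , inj₂
    (refl ∷ ≋-trans (++⁺ʳ (y ∷ []) w≋) (≋-reflexive (List.++-assoc (twos j) (1# ∷ []) (y ∷ []))))

  -- The cyclic word (1, N, 1, 2, …, 2) with r entries 2, where N stands for n-2 = r+1.
  module Word (charZero : CharZero R) (r : ℕ) (N : A) (N≈ι[1+r] : N ≈ ι (suc r)) where

    word : List A
    word = 1# ∷ N ∷ 1# ∷ twos r

    -- Admissible w: if w can be the inner block of the reducing λ-quiddity, it has the claimed shape.
    Admissible : List A → Set (c ⊔ ℓ)
    Admissible w = 1 ≤ length w → length w ≤ r → Is±1 (K w) → TwosWithOneAtEnd w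

    admissible-resp : ∀ {w w′} → w ≋ w′ → Admissible w′ → Admissible w
    admissible-resp w≋w′ adm 1≤|w| |w|≤r ±1
      with adm (≡.subst (1 ≤_) |w|≡|w′| 1≤|w|) (≡.subst (_≤ r) |w|≡|w′| |w|≤r) (Is±1-resp (proj₁ (K-cong w≋w′)) ±1)
      where |w|≡|w′| = ≋-length w≋w′
    ... | j , inj₁ w′≋ = j , inj₁ (≋-trans w≋w′ w′≋)
    ... | j , inj₂ w′≋ = j , inj₂ (≋-trans w≋w′ w′≋)

    twosWithOneAtEnd⇒admissible : ∀ {w} → TwosWithOneAtEnd w → Admissible w
    twosWithOneAtEnd⇒admissible good _ _ _ = good

    tooLong⇒admissible : ∀ {w} → r < length w → Admissible w
    tooLong⇒admissible r<|w| _ |w|≤r _ = ⊥-elim (ℕ.<⇒≱ r<|w| |w|≤r)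

    []-admissible : Admissible []
    []-admissible ()

    large⇒admissible : ∀ {w} → (length w ≤ r → ∃ λ m → K w ≈ ι (2 +ℕ m)) → Admissible w
    large⇒admissible large _ |w|≤r ±1 with large |w|≤r
    ... | m , K≈ = ⊥-elim (ι[2+m]-not-±1 charZero m K≈ ±1)

    twos-admissible : ∀ p → Admissible (twos p)
    twos-admissible zero    = []-admissible
    twos-admissible (suc p) = large⇒admissible (λ _ → p , proj₁ (K-twos (suc p)))

    data NTail : List A → Set c where
      []     : NTail []
      1∷twos : ∀ q → NTail (1# ∷ twos q)

    data ThroughN : List A → Set c where
      N∷_       : ∀ {ρ} → NTail ρ → ThroughN (N ∷ ρ)
      twos_1N∷_ : ∀ p {ρ} → NTail ρ → ThroughN (twos p ++ 1# ∷ N ∷ ρ)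

    K-NTail : ∀ {ρ} → NTail ρ → K ρ ≈ 1# × K′ ρ ≈ - ι (length ρ)
    K-NTail []         = refl , sym -0#≈0#
    K-NTail (1∷twos q) = K≈ , trans (K′-∷ 1# (twos q)) (-‿cong (trans (proj₁ (K-twos q)) ι-length))
      where
      ι-length : ι (suc q) ≈ ι (suc (length (twos q)))
      ι-length = reflexive (≡.cong (λ l → ι (suc l)) (≡.sym (List.length-replicate q)))
      K≈ : K (1# ∷ twos q) ≈ 1#
      K≈ = begin
        K (1# ∷ twos q)                ≈⟨ K-∷ 1# (twos q) ⟩
        1# * K (twos q) + K′ (twos q)  ≈⟨ +-cong (*-congˡ (proj₁ (K-twos q))) (proj₂ (K-twos q)) ⟩
        1# * ι (suc q) + - ι q         ≈⟨ solve 1 (λ x → con (+ 1) :* (con (+ 1) :+ x) :+ :- x := con (+ 1)) refl (ι q) ⟩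
        1#                             ∎

    K-N∷ : ∀ {ρ} → NTail ρ → K (N ∷ ρ) + ι (length ρ) ≈ N × K′ (N ∷ ρ) ≈ - 1#
    K-N∷ {ρ} tail = K≈ , trans (K′-∷ N ρ) (-‿cong (proj₁ (K-NTail tail)))
      where
      K≈ : K (N ∷ ρ) + ι (length ρ) ≈ N
      K≈ = begin
        K (N ∷ ρ) + ι (length ρ)       ≈⟨ +-congʳ (K-∷ N ρ) ⟩
        (N * K ρ + K′ ρ) + ι (length ρ) ≈⟨ +-congʳ (+-cong (*-congˡ (proj₁ (K-NTail tail))) (proj₂ (K-NTail tail))) ⟩
        (N * 1# + - ι (length ρ)) + ι (length ρ)
          ≈⟨ solve 2 (λ n l → (n :* con (+ 1) :+ :- l) :+ l := n) refl N (ι (length ρ)) ⟩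
        N                              ∎

    K-ThroughN : ∀ {w} → ThroughN w → K w + ι (length w) ≈ 1# + N
    K-ThroughN (N∷_ {ρ} tail) = begin
      K (N ∷ ρ) + (1# + ι (length ρ))  ≈⟨ solve 2 (λ k l → k :+ (con (+ 1) :+ l) := con (+ 1) :+ (k :+ l)) refl (K (N ∷ ρ)) (ι (length ρ)) ⟩
      1# + (K (N ∷ ρ) + ι (length ρ))  ≈⟨ +-congˡ (proj₁ (K-N∷ tail)) ⟩
      1# + N                           ∎
    K-ThroughN (twos_1N∷_ p {ρ} tail) = begin
      K w + ι (length w)
        ≈⟨ +-cong (proj₁ (K-twos-1∷ p (N ∷ ρ))) (reflexive (≡.cong ι (length-replicate-++ p (ι 2) (1# ∷ N ∷ ρ)))) ⟩
      (K (N ∷ ρ) + ι (suc p) * K′ (N ∷ ρ)) + ι (p +ℕ suc (suc (length ρ)))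
        ≈⟨ +-cong (+-congˡ (*-congˡ (proj₂ (K-N∷ tail)))) (ι-+ p (suc (suc (length ρ)))) ⟩
      (K (N ∷ ρ) + ι (suc p) * - 1#) + (ι p + (1# + (1# + ι (length ρ))))
        ≈⟨ solve 3 (λ k x l → (k :+ (con (+ 1) :+ x) :* (:- con (+ 1))) :+ (x :+ (con (+ 1) :+ (con (+ 1) :+ l)))
                              := con (+ 1) :+ (k :+ l)) refl (K (N ∷ ρ)) (ι p) (ι (length ρ)) ⟩
      1# + (K (N ∷ ρ) + ι (length ρ))  ≈⟨ +-congˡ (proj₁ (K-N∷ tail)) ⟩
      1# + N                           ∎
      where
      w : List A
      w = twos p ++ 1# ∷ N ∷ ρ

    throughN-admissible : ∀ {w} → ThroughN w → Admissible w
    throughN-admissible {w} through = large⇒admissible λ |w|≤r → large (ℕ.m≤n⇒∃[o]m+o≡n |w|≤r)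
      where
      large : (∃ λ m → length w +ℕ m ≡ r) → ∃ λ m → K w ≈ ι (2 +ℕ m)
      large (m , |w|+m≡r) = m , (begin
        K w                                        ≈⟨ solve 2 (λ k l → k := (k :+ l) :- l) refl (K w) (ι (length w)) ⟩
        (K w + ι (length w)) - ι (length w)        ≈⟨ +-congʳ (trans (K-ThroughN through) (+-congˡ N≈ι[1+r])) ⟩
        (1# + ι (suc r)) - ι (length w)            ≡⟨ ≡.cong (λ s → (1# + ι (suc s)) - ι (length w)) (≡.sym |w|+m≡r) ⟩
        (1# + ι (suc (length w +ℕ m))) - ι (length w) ≈⟨ +-congʳ (+-congˡ (+-congˡ (ι-+ (length w) m))) ⟩
        (1# + (1# + (ι (length w) + ι m))) - ι (length w)
          ≈⟨ solve 2 (λ l x → (con (+ 1) :+ (con (+ 1) :+ (l :+ x))) :- l := con (+ 1) :+ (con (+ 1) :+ x)) refl (ι (length w)) (ι m) ⟩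
        ι (2 +ℕ m)                                 ∎)

    open Suffixes Admissible

    twos-suffixes : ∀ q → AllSuffixes (twos q)
    twos-suffixes q m = ≡.subst Admissible (≡.sym (drop-replicate m q (ι 2))) (twos-admissible (q ∸ m))

    twos-1-suffixes : ∀ p → AllSuffixes (twos p ++ 1# ∷ [])
    twos-1-suffixes zero    = allSuffixes-∷ (twosWithOneAtEnd⇒admissible (0 , inj₂ ≋-refl)) (allSuffixes-[] []-admissible)
    twos-1-suffixes (suc p) = allSuffixes-∷ (twosWithOneAtEnd⇒admissible (suc p , inj₂ ≋-refl)) (twos-1-suffixes p)

    twos-1N-suffixes : ∀ p → AllSuffixes (twos p ++ 1# ∷ N ∷ [])
    twos-1N-suffixes zero    = allSuffixes-∷ (throughN-admissible (twos 0 1N∷ []))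
                                (allSuffixes-∷ (throughN-admissible (N∷ [])) (allSuffixes-[] []-admissible))
    twos-1N-suffixes (suc p) = allSuffixes-∷ (throughN-admissible (twos (suc p) 1N∷ [])) (twos-1N-suffixes p)

    centred-suffixes : ∀ p q → AllSuffixes (twos p ++ 1# ∷ N ∷ 1# ∷ twos q)
    centred-suffixes zero    q = allSuffixes-∷ (throughN-admissible (twos 0 1N∷ 1∷twos q))
                                  (allSuffixes-∷ (throughN-admissible (N∷ 1∷twos q))
                                  (allSuffixes-∷ (twosWithOneAtEnd⇒admissible (q , inj₁ ≋-refl)) (twos-suffixes q)))
    centred-suffixes (suc p) q = allSuffixes-∷ (throughN-admissible (twos (suc p) 1N∷ 1∷twos q)) (centred-suffixes p q)

    data Rotation : List A → Set c where
      centred : ∀ p q → Rotation (twos p ++ 1# ∷ N ∷ 1# ∷ twos q)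
      N-first : Rotation (N ∷ 1# ∷ twos r ++ 1# ∷ [])
      N-last  : Rotation (1# ∷ twos r ++ 1# ∷ N ∷ [])

    r<length-∷twos : ∀ x ys → r < length (x ∷ twos r ++ ys)
    r<length-∷twos x ys = s≤s (≡.subst (r ≤_) (≡.sym (length-replicate-++ r (ι 2) ys)) (ℕ.m≤m+n r (length ys)))

    rotation-suffixes : ∀ {X} → Rotation X → AllSuffixes X
    rotation-suffixes (centred p q) = centred-suffixes p q
    rotation-suffixes N-first       = allSuffixes-∷ (tooLong⇒admissible (ℕ.m<n⇒m<1+n (r<length-∷twos 1# (1# ∷ []))))
                                        (allSuffixes-∷ (tooLong⇒admissible (r<length-∷twos 1# (1# ∷ []))) (twos-1-suffixes r))
    rotation-suffixes N-last        = allSuffixes-∷ (tooLong⇒admissible (r<length-∷twos 1# (1# ∷ N ∷ [])))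
                                        (twos-1N-suffixes r)

    rotation-word : ∀ i → Rotation (rotate R i word)
    rotation-word zero                = ≡.subst Rotation (≡.sym (List.++-identityʳ word)) (centred 0 r)
    rotation-word (suc zero)          = N-first
    rotation-word (suc (suc zero))    = N-last
    rotation-word (suc (suc (suc j))) = ≡.subst Rotation
      (≡.sym (≡.cong₂ (λ u v → u ++ 1# ∷ N ∷ 1# ∷ v) (drop-replicate j r (ι 2)) (take-replicate j r (ι 2))))
      (centred (r ∸ j) (j ⊓ r))

    rotation-twos-1N1 : ∀ i → Rotation (rotate R i (twos r ++ 1# ∷ N ∷ 1# ∷ []))
    rotation-twos-1N1 i with i ℕ.≤? r
    ... | yes i≤r = ≡.subst Rotation (≡.sym (≡.trans
          (≡.cong₂ _++_ (drop-replicate-++ (ι 2) Z i≤r) (take-replicate-++ (ι 2) Z i≤r))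
          (List.++-assoc (twos (r ∸ i)) Z (twos i))))
          (centred (r ∸ i) i)
      where
      Z : List A
      Z = 1# ∷ N ∷ 1# ∷ []
    ... | no i≰r with ℕ.m≤n⇒∃[o]m+o≡n (ℕ.≰⇒> i≰r)
    ... | k , 1+r+k≡i = ≡.subst (λ i → Rotation (rotate R i (twos r ++ Z))) (≡.trans (ℕ.+-suc r k) 1+r+k≡i)
          (≡.subst Rotation (≡.sym (≡.cong₂ _++_ (drop-+-replicate-++ r (suc k) (ι 2) Z) (take-+-replicate-++ r (suc k) (ι 2) Z)))
            (beyond k))
      where
      Z : List A
      Z = 1# ∷ N ∷ 1# ∷ []
      beyond : ∀ o → Rotation (drop (suc o) Z ++ twos r ++ take (suc o) Z)
      beyond zero          = N-first
      beyond (suc zero)    = N-last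
      beyond (suc (suc o)) = ≡.subst Rotation
        (≡.sym (≡.cong₂ (λ u v → u ++ twos r ++ 1# ∷ N ∷ 1# ∷ v) (List.drop-[] o) (List.take-[] o))) (centred r 0)

    reverse-word : reverse word ≡ twos r ++ 1# ∷ N ∷ 1# ∷ []
    reverse-word = ≡.trans (List.reverse-++ (1# ∷ N ∷ 1# ∷ []) (twos r))
                           (≡.cong (_++ 1# ∷ N ∷ 1# ∷ []) (reverse-replicate r (ι 2)))

    window-admissible : ∀ {X} → _∼_ R word X → AllSuffixes X
    window-admissible (i , inj₁ X≋) m = admissible-resp (Pointwise-drop m X≋) (rotation-suffixes (rotation-word i) m)
    window-admissible (i , inj₂ X≋) m = admissible-resp (Pointwise-drop m X≋)
      (rotation-suffixes (≡.subst (λ W → Rotation (rotate R i W)) (≡.sym reverse-word) (rotation-twos-1N1 i)) m)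

  ι[3+r]-2 : ∀ r → ι (3 +ℕ r) - ι 2 ≈ ι (suc r)
  ι[3+r]-2 r = solve 1 (λ x → (con (+ 1) :+ (con (+ 1) :+ (con (+ 1) :+ x))) :- :natA 2 := con (+ 1) :+ x) refl (ι r)

mainTheorem16 : {c ℓ : Level} (R : CommutativeRing c ℓ) →
    let open CommutativeRing R renaming (Carrier to A) in
    CharZero R →
    (n k : ℕ) → 4 ≤ n → 3 ≤ k → k ≤ n ∸ 1 →
    (b : List A) → length b ≡ k →
    IsLambdaQuiddity R b →
    (∃ λ (cs : List A) → (length cs ≡ n +ℕ 2 ∸ k) ×
      _∼_ R (1# ∷ (natA R n - natA R 2) ∷ 1# ∷ replicate (n ∸ 3) (natA R 2))
            (_⊕_ R cs b)) →
    ∃₂ λ (x y : A) → ∃ λ (j : ℕ) →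
      _≈L_ R b (x ∷ 1# ∷ (replicate j (natA R 2) ++ (y ∷ [])))
      ⊎ _≈L_ R b (x ∷ (replicate j (natA R 2) ++ (1# ∷ y ∷ [])))
mainTheorem16 R _ _ _ _ (s≤s (s≤s (s≤s _))) _ []       () _ _
mainTheorem16 R _ _ _ _ (s≤s (s≤s (s≤s _))) _ (_ ∷ []) () _ _
mainTheorem16 R charZero (suc (suc (suc (suc r)))) (suc (suc (suc k))) _ _ (s≤s (s≤s (s≤s k≤r)))
              (b₁ ∷ b₂ ∷ bs) |b|≡k quiddity (cs , |cs|≡ , rotation) =
  reduced-shape R b₁ w y b≡ (inner-admissible 1≤|w| |w|≤1+r inner-±1)
  where
  open CommutativeRing R renaming (Carrier to A)
  open Word R charZero (suc r) _ (ι[3+r]-2 R (suc r))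
  w : List A
  w = proj₁ (initLast′ R b₂ bs)
  y : A
  y = proj₂ (initLast′ R b₂ bs)
  b≡ : b₁ ∷ b₂ ∷ bs ≡ b₁ ∷ w ++ y ∷ []
  b≡ = ≡.cong (b₁ ∷_) (initLast′-++ R b₂ bs)
  |w|≡1+k : length w ≡ suc k
  |w|≡1+k = ≡.trans (initLast′-length R b₂ bs) (ℕ.suc-injective (ℕ.suc-injective |b|≡k))
  1≤|w| : 1 ≤ length w
  1≤|w| = ≡.subst (1 ≤_) (≡.sym |w|≡1+k) (s≤s z≤n)
  |w|≤1+r : length w ≤ suc r
  |w|≤1+r = ≡.subst (_≤ suc r) (≡.sym |w|≡1+k) (s≤s k≤r)
  inner-±1 : Is±1 R (K R w)
  inner-±1 = quiddity⇒inner-±1 R b₁ w y (≡.subst (IsLambdaQuiddity R) b≡ quiddity)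
  inner-admissible : Admissible w
  inner-admissible = ≡.subst Admissible (drop-⊕ R {cs} b₁ b₂ bs (≡.subst (2 ≤_) (≡.sym |cs|≡) (2≤[3+r]∸k k≤r)))
                       (window-admissible rotation (length cs))
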